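{- Let $D$ be a Hamiltonian digraph and let $C$ be a Hamiltonian cycle of $D$. If for every $v\in V(D)$ there is an even chord of $C$ with head $v$, then $D$ has a strong $2$-partition.
   Context: All digraphs are finite, loopless, without parallel arcs (opposite arcs are allowed). For a cycle $C=x_0x_1\dots x_{n-1}x_0$ (indices mod $n$), a chord of $C$ is an arc $x_px_q$ of $D$ with $x_q\ne x_{p+1}$ (and $x_q\ne x_p$); its length is the length of the directed subpath $x_px_{p+1}\dots x_q$ of $C$, and the chord is even if this length is even. A 2-partition of $D$ is a partition $(V_1,V_2)$ of $V(D)$ into two parts; $B_D(V_1,V_2)$ is the spanning subdigraph of $D$ whose arcs are the arcs of $D$ with one end in $V_1$ and the other in $V_2$. The 2-partition is strong if $B_D(V_1,V_2)$ is strongly connected (for every ordered pair $(u,v)$ of vertices there is a directed $uv$-path in it). -}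

module Defs where

open import Data.Nat using (ℕ; zero; suc; _+_; _∸_; _%_; _≤_)
open import Data.Nat.DivMod using (m%n<n)
open import Data.Nat.Divisibility using (_∣_)
open import Data.Fin using (Fin; toℕ; fromℕ<)
open import Data.Bool using (Bool; true; false)
open import Data.Product using (Σ; _×_; ∃; ∃-syntax)
open import Relation.Binary.PropositionalEquality using (_≡_; _≢_)
open import Relation.Binary.Construct.Closure.ReflexiveTransitive using (Star)
open import Function.Definitions using (Bijective)

-- A relation has
-- no parallel arcs by construction; opposite arcs are allowed.
record Digraph (n : ℕ) : Set where
  field
    arc      : Fin n → Fin n → Bool
    loopless : ∀ v → arc v v ≡ false
open Digraph public

next : ∀ {n} → Fin n → Fin n
next {suc k} i = fromℕ< (m%n<n (suc (toℕ i)) (suc k))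

-- length of the directed subpath x_p x_{p+1} … x_q of a cycle of length n,
-- i.e. (q - p) mod n
cycLen : ∀ {n} → Fin n → Fin n → ℕ
cycLen {suc k} p q = (toℕ q + suc k ∸ toℕ p) % suc k

-- A Hamiltonian cycle C = x_0 x_1 … x_{n-1} x_0 of D: a bijective
-- enumeration x : Fin n → Fin n of all vertices (n ≥ 2 since a cycle
-- has length at least 2) with x_i x_{i+1} an arc for each i (mod n).
record HamiltonianCycle {n : ℕ} (D : Digraph n) : Set where
  field
    length≥2 : 2 ≤ n
    x        : Fin n → Fin n
    bij      : Bijective _≡_ _≡_ x
    cyc      : ∀ i → arc D (x i) (x (next i)) ≡ true
open HamiltonianCycle public

Hamiltonian : ∀ {n} → Digraph n → Set
Hamiltonian D = HamiltonianCycle D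

IsChord : ∀ {n} {D : Digraph n} → HamiltonianCycle D → Fin n → Fin n → Set
IsChord {D = D} C p q =
  (arc D (x C p) (x C q) ≡ true) × (x C q ≢ x C (next p)) × (x C q ≢ x C p)

IsEvenChord : ∀ {n} {D : Digraph n} → HamiltonianCycle D → Fin n → Fin n → Set
IsEvenChord C p q = IsChord C p q × (2 ∣ cycLen p q)

HasEvenChordWithHead : ∀ {n} {D : Digraph n} → HamiltonianCycle D → Fin n → Set
HasEvenChordWithHead C v = ∃[ p ] ∃[ q ] (IsEvenChord C p q × x C q ≡ v)

-- arcs of B_D(V₁,V₂), where the 2-partition is given by its
-- indicator V : Fin n → Bool  (V₁ = {v | V v ≡ true}, V₂ = complement)
BArc : ∀ {n} → Digraph n → (Fin n → Bool) → Fin n → Fin n → Set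
BArc D V u w = (arc D u w ≡ true) × (V u ≢ V w)

BPath : ∀ {n} → Digraph n → (Fin n → Bool) → Fin n → Fin n → Set
BPath D V = Star (BArc D V)

IsStrong2Partition : ∀ {n} → Digraph n → (Fin n → Bool) → Set
IsStrong2Partition D V =
  (∃[ a ] V a ≡ true) × (∃[ b ] V b ≡ false) × (∀ u w → BPath D V u w)

HasStrong2Partition : ∀ {n} → Digraph n → Set
HasStrong2Partition D = ∃[ V ] IsStrong2Partition D V

-- Colour each vertex by the parity of its position on C.  If n is even, every arc of C
-- changes colour, so C itself lies in B_D and the partition is strong.  If n is odd, only the
-- closing arc x_{n-1} x_0 keeps its colour, and an even chord x_t x_b changes colour exactly
-- when it runs backwards (b < t).  If every cut between consecutive positions 1..n-1 is jumped
-- over by such a backward chord, every vertex reaches x_0: walk forward to the tail of a chord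
-- jumping over the current position and land strictly before it.  Otherwise some prefix
-- [0, s) of positions is closed under taking chord tails; moving the starting point of C one
-- step forward either fixes this or leaves a shorter closed prefix, and a closed prefix of
-- length 1 would make x_0 the tail of its own chord.  So some rotation of C works.
module Submission where

open import Defs
open import Data.Nat using (ℕ; zero; suc; _+_; _∸_; _%_; _<_; _≤_; z≤n; s≤s; z<s; NonZero; parity; _≤?_)
open import Data.Nat.Properties
  using (suc-injective; +-identityʳ; +-suc; <⇒≤; ≤-pred; ≤-refl; ≤-trans; <-trans; ≤-<-trans; <-≤-trans; <-irrefl; ≰⇒>;
         m≤n⇒m<n∨m≡n; n<1+n; n<1⇒n≡0; m<m+n; m≤n+m; m+n∸m≡n; m+n∸n≡m; m∸n+n≡m; m+[n∸m]≡n;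
         +-∸-comm; ∸-monoʳ-<)
open import Data.Nat.DivMod using (n%n≡0; m<n⇒m%n≡m; [m+n]%n≡m%n)
open import Data.Nat.Divisibility using (_∣_; divides)
open import Data.Nat.Induction as ℕ using ()
open import Data.Parity.Base as ℙ using (Parity; 0ℙ; 1ℙ; _⁻¹)
open import Data.Parity.Properties using (⁻¹-selfInverse; p≢p⁻¹; suc-homo-⁻¹; +-homo-+; *-homo-*; *-zeroʳ; +-comm)
open import Data.Fin as Fin using (Fin; toℕ; fromℕ; inject₁)
open import Data.Fin.Properties
  using (toℕ-injective; toℕ-fromℕ<; toℕ-fromℕ; toℕ-inject₁; toℕ<n; ≤fromℕ; any?; all?; ¬∀⟶∃¬)
open import Data.Fin.Induction using (<-wellFounded)
open import Induction.WellFounded using (Acc; acc)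
open import Data.Bool using (Bool; true; false)
open import Data.Product using (Σ; _×_; _,_; proj₁; proj₂; ∃; ∃-syntax)
open import Data.Sum using (_⊎_; inj₁; inj₂)
open import Data.Empty using (⊥-elim)
open import Function using (_∘_)
open import Relation.Nullary using (¬_; yes; no; contradiction)
open import Relation.Nullary.Decidable using (_×-dec_)
open import Relation.Unary using (Decidable)
open import Relation.Binary.PropositionalEquality
open import Relation.Binary.Construct.Closure.ReflexiveTransitive using (ε; _◅_; _◅◅_)

parity-suc : ∀ k → parity (suc k) ≡ parity k ⁻¹
parity-suc k = sym (⁻¹-selfInverse (suc-homo-⁻¹ k))

2∣⇒parity≡0ℙ : ∀ {k} → 2 ∣ k → parity k ≡ 0ℙ
2∣⇒parity≡0ℙ (divides q refl) = trans (*-homo-* q 2) (*-zeroʳ (parity q))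

-- (b + N ∸ t) % N is the length of the path from position t to position b on a cycle of
-- length N; for b < t this path passes through position 0.
parity-wrapping-even-path : ∀ {N b t} .{{_ : NonZero N}} → b < t → t < N → parity N ≡ 1ℙ →
                            2 ∣ (b + N ∸ t) % N → parity t ≡ parity b ⁻¹
parity-wrapping-even-path {N} {b} {t} b<t t<N odd-N 2∣len = begin
  parity t                        ≡⟨ cong (ℙ._+ parity t) (sym (2∣⇒parity≡0ℙ 2∣len′)) ⟩
  parity len ℙ.+ parity t         ≡⟨ sym (+-homo-+ len t) ⟩
  parity (len + t)                ≡⟨ cong parity (m∸n+n≡m t≤b+N) ⟩
  parity (b + N)                  ≡⟨ +-homo-+ b N ⟩
  parity b ℙ.+ parity N           ≡⟨ cong (parity b ℙ.+_) odd-N ⟩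
  parity b ℙ.+ 1ℙ                 ≡⟨ +-comm (parity b) 1ℙ ⟩
  parity b ⁻¹                     ∎
  where
  open ≡-Reasoning
  len = b + N ∸ t
  t≤b+N : t ≤ b + N
  t≤b+N = ≤-trans (<⇒≤ t<N) (m≤n+m N b)
  len<N : len < N
  len<N = subst (len <_) (m+n∸m≡n b N) (∸-monoʳ-< b<t t≤b+N)
  2∣len′ : 2 ∣ len
  2∣len′ = subst (2 ∣_) (m<n⇒m%n≡m len<N) 2∣len

module _ {n : ℕ} where

  prev : Fin (suc n) → Fin (suc n)
  prev Fin.zero    = fromℕ n
  prev (Fin.suc i) = inject₁ i

  toℕ-next : (i : Fin (suc n)) → suc (toℕ i) < suc n → toℕ (next i) ≡ suc (toℕ i)
  toℕ-next i 1+i<1+n = trans (toℕ-fromℕ< _) (m<n⇒m%n≡m 1+i<1+n)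

  toℕ-next-fromℕ : toℕ (next (fromℕ n)) ≡ 0
  toℕ-next-fromℕ =
    trans (toℕ-fromℕ< _) (trans (cong (λ k → suc k % suc n) (toℕ-fromℕ n)) (n%n≡0 (suc n)))

  next-prev : ∀ j → next (prev j) ≡ j
  next-prev Fin.zero    = toℕ-injective toℕ-next-fromℕ
  next-prev (Fin.suc i) = toℕ-injective (begin
    toℕ (next (inject₁ i)) ≡⟨ toℕ-next (inject₁ i) 1+i<1+n ⟩
    suc (toℕ (inject₁ i))  ≡⟨ cong suc (toℕ-inject₁ i) ⟩
    suc (toℕ i)            ∎)
    where
    open ≡-Reasoning
    1+i<1+n : suc (toℕ (inject₁ i)) < suc n
    1+i<1+n = subst (λ k → suc k < suc n) (sym (toℕ-inject₁ i)) (s≤s (toℕ<n i))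

  toℕ-prev-suc : ∀ j {k} → toℕ j ≡ suc k → toℕ (prev j) ≡ k
  toℕ-prev-suc (Fin.suc i) eq = trans (toℕ-inject₁ i) (suc-injective eq)

  prev-next : ∀ i → prev (next i) ≡ i
  prev-next i with m≤n⇒m<n∨m≡n (≤-pred (toℕ<n i))
  ... | inj₁ i<n = toℕ-injective (toℕ-prev-suc (next i) (toℕ-next i (s≤s i<n)))
  ... | inj₂ i≡n = begin
    prev (next i)          ≡⟨ cong (λ k → prev (next k)) i≡fromℕ ⟩
    prev (next (fromℕ n))  ≡⟨ cong prev (toℕ-injective {j = Fin.zero} toℕ-next-fromℕ) ⟩
    fromℕ n                ≡⟨ sym i≡fromℕ ⟩
    i                      ∎
    where
    open ≡-Reasoning
    i≡fromℕ : i ≡ fromℕ n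
    i≡fromℕ = toℕ-injective (trans i≡n (sym (toℕ-fromℕ n)))

  cycLen-prev : ∀ p q → cycLen (prev p) (prev q) ≡ cycLen p q
  cycLen-prev Fin.zero Fin.zero rewrite toℕ-fromℕ n = cong (_% suc n) (m+n∸m≡n n (suc n))
  cycLen-prev Fin.zero (Fin.suc q) rewrite toℕ-fromℕ n | toℕ-inject₁ q = begin
    (toℕ q + suc n ∸ n) % suc n ≡⟨ cong (λ k → (k ∸ n) % suc n) (+-suc (toℕ q) n) ⟩
    (suc (toℕ q) + n ∸ n) % suc n ≡⟨ cong (_% suc n) (m+n∸n≡m (suc (toℕ q)) n) ⟩
    suc (toℕ q) % suc n           ≡⟨ sym ([m+n]%n≡m%n (suc (toℕ q)) (suc n)) ⟩
    (suc (toℕ q) + suc n) % suc n ∎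
    where open ≡-Reasoning
  cycLen-prev (Fin.suc p) Fin.zero rewrite toℕ-fromℕ n | toℕ-inject₁ p = begin
    (n + suc n ∸ toℕ p) % suc n   ≡⟨ cong (_% suc n) (+-∸-comm (suc n) (<⇒≤ (toℕ<n p))) ⟩
    (n ∸ toℕ p + suc n) % suc n   ≡⟨ [m+n]%n≡m%n (n ∸ toℕ p) (suc n) ⟩
    (n ∸ toℕ p) % suc n           ∎
    where open ≡-Reasoning
  cycLen-prev (Fin.suc p) (Fin.suc q) rewrite toℕ-inject₁ p | toℕ-inject₁ q = refl

oddᵇ : Parity → Bool
oddᵇ 0ℙ = false
oddᵇ 1ℙ = true

oddᵇ-injective : ∀ {p q} → oddᵇ p ≡ oddᵇ q → p ≡ q
oddᵇ-injective {0ℙ} {0ℙ} _ = refl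
oddᵇ-injective {1ℙ} {1ℙ} _ = refl

module _ {m : ℕ} (D : Digraph (suc (suc m))) where

  private
    N = suc (suc m)
    F = Fin N

  -- The cycle as a sequence of positions starting at a chosen vertex, with an even chord into
  -- every position b whose tail is at position tail b.
  record ChordedCycle : Set where
    field
      vertex       : F → F
      index        : F → F
      vertex-index : ∀ v → vertex (index v) ≡ v
      index-vertex : ∀ i → index (vertex i) ≡ i
      cycle-arc    : ∀ i → arc D (vertex i) (vertex (next i)) ≡ true
      tail         : F → F
      chord-arc    : ∀ b → arc D (vertex (tail b)) (vertex b) ≡ true
      tail≢        : ∀ b → tail b ≢ b
      chord-even   : ∀ b → 2 ∣ cycLen (tail b) b

  open ChordedCycle

  rotate : ChordedCycle → ChordedCycle
  rotate c = record
    { vertex       = λ i → vertex c (next i)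
    ; index        = λ v → prev (index c v)
    ; vertex-index = λ v → trans (cong (vertex c) (next-prev (index c v))) (vertex-index c v)
    ; index-vertex = λ i → trans (cong prev (index-vertex c (next i))) (prev-next i)
    ; cycle-arc    = λ i → cycle-arc c (next i)
    ; tail         = λ b → prev (tail c (next b))
    ; chord-arc    = λ b → subst (λ i → arc D (vertex c i) (vertex c (next b)) ≡ true)
                               (sym (next-prev _)) (chord-arc c (next b))
    ; tail≢        = λ b eq → tail≢ c (next b) (trans (sym (next-prev _)) (cong next eq))
    ; chord-even   = λ b → subst (λ i → 2 ∣ cycLen (prev (tail c (next b))) i) (prev-next b)
                             (subst (2 ∣_) (sym (cycLen-prev (tail c (next b)) (next b)))
                               (chord-even c (next b)))
    }

  -- The cut between positions r - 1 and r is passed over by the chord into some b < r.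
  Jumped : ChordedCycle → F → Set
  Jumped c r = ∃[ b ] (b Fin.< r × r Fin.≤ tail c b)

  Covered : ChordedCycle → Set
  Covered c = ∀ r → Jumped c (Fin.suc r)

  record ClosedPrefix (c : ChordedCycle) (s : ℕ) : Set where
    field
      nonempty : 0 < s
      proper   : s < N
      closed   : ∀ b → toℕ b < s → toℕ (tail c b) < s

  jumped? : ∀ c → Decidable (Jumped c)
  jumped? c r = any? (λ b → b Fin.<? r ×-dec r Fin.≤? tail c b)

  covered-or-closedPrefix : ∀ c → Covered c ⊎ ∃ (ClosedPrefix c)
  covered-or-closedPrefix c with all? (jumped? c ∘ Fin.suc)
  ... | yes covered = inj₁ covered
  ... | no ¬covered with ¬∀⟶∃¬ _ _ (jumped? c ∘ Fin.suc) ¬covered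
  ... | r , ¬jumped = inj₂ (suc (toℕ r) , record
    { nonempty = z<s
    ; proper   = toℕ<n (Fin.suc r)
    ; closed   = λ b b<r → ≰⇒> (λ r≤t → ¬jumped (b , b<r , r≤t))
    })

  ¬closedPrefix-1 : ∀ c → ¬ ClosedPrefix c 1
  ¬closedPrefix-1 c p =
    tail≢ c Fin.zero (toℕ-injective (n<1⇒n≡0 (ClosedPrefix.closed p Fin.zero z<s)))

  -- If the prefix [0, s′) of the rotation is closed and reaches past s, it misses the old
  -- position 0, so the closed prefix [0, 1 + s) of c shifts down to a closed prefix [0, s).
  closedPrefix-rotate : ∀ {c s s′} → 0 < s → ClosedPrefix c (suc s) →
                        ClosedPrefix (rotate c) s′ → s < s′ → ClosedPrefix (rotate c) s
  closedPrefix-rotate {c} {s} {s′} 0<s p p′ s<s′ = record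
    { nonempty = 0<s
    ; proper   = <-trans (n<1+n s) (ClosedPrefix.proper p)
    ; closed   = closed
    }
    where
    shift : ∀ {t} → toℕ t < suc s → toℕ (prev t) < s′ → toℕ (prev t) < s
    shift {Fin.zero}  _         last<s′ =
      ⊥-elim (<-irrefl (toℕ-fromℕ (suc m)) (<-≤-trans last<s′ (≤-pred (ClosedPrefix.proper p′))))
    shift {Fin.suc t} (s≤s t<s) _       = subst (_< s) (sym (toℕ-inject₁ t)) t<s

    closed : ∀ b → toℕ b < s → toℕ (prev (tail c (next b))) < s
    closed b b<s =
      shift (ClosedPrefix.closed p (next b) next-b<1+s) (ClosedPrefix.closed p′ b (<-trans b<s s<s′))
      where
      next-b<1+s : toℕ (next b) < suc s
      next-b<1+s =
        subst (_< suc s) (sym (toℕ-next b (<-trans (s≤s b<s) (ClosedPrefix.proper p)))) (s≤s b<s)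

  covered-rotation-from-closedPrefix : ∀ {s} → Acc _<_ s → ∀ c → ClosedPrefix c s → Σ ChordedCycle Covered
  covered-rotation-from-closedPrefix {zero}        _         c p = contradiction (ClosedPrefix.nonempty p) λ ()
  covered-rotation-from-closedPrefix {suc zero}    _         c p = contradiction p (¬closedPrefix-1 c)
  covered-rotation-from-closedPrefix {suc (suc s)} (acc rec) c p with covered-or-closedPrefix (rotate c)
  ... | inj₁ covered = rotate c , covered
  ... | inj₂ (s′ , p′) with s′ ≤? suc s
  ...   | yes s′≤1+s = covered-rotation-from-closedPrefix (rec (s≤s s′≤1+s)) (rotate c) p′
  ...   | no  s′≰1+s = covered-rotation-from-closedPrefix (rec ≤-refl) (rotate c)
                          (closedPrefix-rotate z<s p p′ (≰⇒> s′≰1+s))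

  covered-rotation : ChordedCycle → Σ ChordedCycle Covered
  covered-rotation c with covered-or-closedPrefix c
  ... | inj₁ covered = c , covered
  ... | inj₂ (s , p) = covered-rotation-from-closedPrefix (ℕ.<-wellFounded s) c p

  module _ (c : ChordedCycle) where

    side : F → Bool
    side v = oddᵇ (parity (toℕ (index c v)))

    side-vertex : ∀ i → side (vertex c i) ≡ oddᵇ (parity (toℕ i))
    side-vertex i = cong (λ j → oddᵇ (parity (toℕ j))) (index-vertex c i)

    crossing : ∀ {i j} → arc D (vertex c i) (vertex c j) ≡ true → parity (toℕ i) ≢ parity (toℕ j) →
               BArc D side (vertex c i) (vertex c j)
    crossing {i} {j} ij parities≢ =
      ij , λ sides≡ →
        parities≢ (oddᵇ-injective (trans (sym (side-vertex i)) (trans sides≡ (side-vertex j))))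

    cycle-crossing : ∀ i → suc (toℕ i) < N → BArc D side (vertex c i) (vertex c (next i))
    cycle-crossing i i<last = crossing (cycle-arc c i) λ eq →
      p≢p⁻¹ (parity (toℕ i)) (trans eq (trans (cong parity (toℕ-next i i<last)) (parity-suc (toℕ i))))

    forward-path : ∀ {i j} → i Fin.≤ j → BPath D side (vertex c i) (vertex c j)
    forward-path {i} {j} i≤j = walk (toℕ j ∸ toℕ i) i (m+[n∸m]≡n i≤j)
      where
      walk : ∀ d k → toℕ k + d ≡ toℕ j → BPath D side (vertex c k) (vertex c j)
      walk zero    k eq = subst (λ l → BPath D side (vertex c k) (vertex c l))
                                (toℕ-injective (trans (sym (+-identityʳ (toℕ k))) eq)) ε
      walk (suc d) k eq = cycle-crossing k k<last ◅ walk d (next k) next-k+d≡j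
        where
        k<last : suc (toℕ k) < N
        k<last = ≤-<-trans (m<m+n (toℕ k) z<s) (subst (_< N) (sym eq) (toℕ<n j))
        next-k+d≡j : toℕ (next k) + d ≡ toℕ j
        next-k+d≡j = trans (cong (_+ d) (toℕ-next k k<last)) (trans (sym (+-suc (toℕ k) d)) eq)

    backward-chord-crossing : parity N ≡ 1ℙ → ∀ b → b Fin.< tail c b →
                              BArc D side (vertex c (tail c b)) (vertex c b)
    backward-chord-crossing odd-N b b<t = crossing (chord-arc c b) λ eq →
      p≢p⁻¹ (parity (toℕ b))
        (trans (sym eq) (parity-wrapping-even-path b<t (toℕ<n (tail c b)) odd-N (chord-even c b)))

    closing-crossing : parity N ≡ 0ℙ → BArc D side (vertex c (fromℕ (suc m))) (vertex c Fin.zero)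
    closing-crossing even-N = crossing last→0 λ eq → contradiction (trans (sym last-odd) eq) λ ()
      where
      last-odd : parity (toℕ (fromℕ (suc m))) ≡ 1ℙ
      last-odd =
        trans (cong parity (toℕ-fromℕ (suc m))) (trans (sym (suc-homo-⁻¹ (suc m))) (cong _⁻¹ even-N))
      last→0 : arc D (vertex c (fromℕ (suc m))) (vertex c Fin.zero) ≡ true
      last→0 = subst (λ i → arc D (vertex c (fromℕ (suc m))) (vertex c i) ≡ true)
                     (toℕ-injective toℕ-next-fromℕ) (cycle-arc c (fromℕ (suc m)))

    to-root-even : parity N ≡ 0ℙ → ∀ i → BPath D side (vertex c i) (vertex c Fin.zero)
    to-root-even even-N i = forward-path (≤fromℕ i) ◅◅ closing-crossing even-N ◅ ε

    to-root-odd : parity N ≡ 1ℙ → Covered c → ∀ i → BPath D side (vertex c i) (vertex c Fin.zero)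
    to-root-odd odd-N covered i = go (<-wellFounded i)
      where
      go : ∀ {i} → Acc Fin._<_ i → BPath D side (vertex c i) (vertex c Fin.zero)
      go {Fin.zero}  _         = ε
      go {Fin.suc r} (acc rec) with covered r
      ... | b , b<r , r≤t =
        forward-path r≤t ◅◅ backward-chord-crossing odd-N b (<-≤-trans b<r r≤t) ◅ go (rec b<r)

    isStrong2Partition : (∀ i → BPath D side (vertex c i) (vertex c Fin.zero)) →
                         IsStrong2Partition D side
    isStrong2Partition to-root =
        (vertex c (Fin.suc Fin.zero) , side-vertex (Fin.suc Fin.zero))
      , (vertex c Fin.zero , side-vertex Fin.zero)
      , λ u w → subst₂ (BPath D side) (vertex-index c u) (vertex-index c w)
                  (to-root (index c u) ◅◅ forward-path {Fin.zero} {index c w} z≤n)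

  hasStrong2Partition : ChordedCycle → HasStrong2Partition D
  hasStrong2Partition c with parity N in parity-N
  ... | 0ℙ = side c , isStrong2Partition c (to-root-even c parity-N)
  ... | 1ℙ with covered-rotation c
  ...   | c′ , covered = side c′ , isStrong2Partition c′ (to-root-odd c′ parity-N covered)

  chordedCycle : (C : HamiltonianCycle D) → (∀ v → HasEvenChordWithHead C v) → ChordedCycle
  chordedCycle C chords = record
    { vertex       = x C
    ; index        = λ v → proj₁ (proj₂ (bij C) v)
    ; vertex-index = x-index
    ; index-vertex = λ i → proj₁ (bij C) (x-index (x C i))
    ; cycle-arc    = cyc C
    ; tail         = λ b → proj₁ (even-chord-into b)
    ; chord-arc    = λ b → proj₁ (proj₂ (even-chord-into b))
    ; tail≢        = λ b → proj₁ (proj₂ (proj₂ (even-chord-into b)))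
    ; chord-even   = λ b → proj₂ (proj₂ (proj₂ (even-chord-into b)))
    }
    where
    x-index : ∀ v → x C (proj₁ (proj₂ (bij C) v)) ≡ v
    x-index v = proj₂ (proj₂ (bij C) v) refl

    even-chord-into : ∀ b → ∃[ t ] (arc D (x C t) (x C b) ≡ true × t ≢ b × 2 ∣ cycLen t b)
    even-chord-into b with chords (x C b)
    ... | t , q , ((t→q , _ , q≢t) , even) , xq≡xb with proj₁ (bij C) xq≡xb
    ...   | refl = t , t→q , (λ t≡q → q≢t (cong (x C) (sym t≡q))) , even

theorem9 : (n : ℕ) (D : Digraph n) (C : HamiltonianCycle D) →
    (∀ v → HasEvenChordWithHead C v) → HasStrong2Partition D
theorem9 zero          D C _      = contradiction (length≥2 C) λ ()
theorem9 (suc zero)    D C _      = contradiction (length≥2 C) λ { (s≤s ()) }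
theorem9 (suc (suc m)) D C chords = hasStrong2Partition D (chordedCycle D C chords)
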